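{- Let $T$ be a finite rooted ordered tree with root $r$ and let $v_1,v_2\in T\setminus\{r\}$ with $v_1<v_2$ in depth-first traversal order of $T$. Then $$\mathsf{pda}(v_1,v_2)=\max_{<}\{x\mid v_1\le x\le v_2,\ \mathrm{depth}_T(x)=\mathrm{depth}_T(v_1,v_2)\},$$ i.e. the primal-dual ancestor of $v_1,v_2$ is the last node, in depth-first order of $T$, among those nodes between $v_1$ and $v_2$ (inclusive) whose depth in $T$ is minimal.
   Context: Depth-first traversal order $<$ on $T$ is preorder. $\mathrm{depth}_T(x)$ is the distance from $r$ to $x$ in $T$, and $\mathrm{depth}_T(v_1,v_2):=\min\{\mathrm{depth}_T(y)\mid v_1\le y\le v_2\}$. $T[v]$ is the subtree of $v$ in $T$ (v and its descendants), and $T^*[v]$ the subtree of $v$ in the dual tree $T^*$. The dual $T^*$ has the same vertex set and root $r$; with $rmc_T(u)$ the rightmost child and $ils_T(u)$ the immediate left sibling of $u$ in $T$: (1a) $r$ has no parent in $T^*$; (1b) if $v=rmc_T(r)$ then $v$ is the rightmost child of $r$ in $T^*$; (2) if $v=rmc_T(u)$ with $u\ne r$, then $v$ is the immediate left sibling of $u$ in $T^*$; (3) if $v=ils_T(u)$, then $v$ is the rightmost child of $u$ in $T^*$. For $v_1\le v_2$ non-root, there is a unique $v\in T\setminus\{r\}$ with $v_1\in T^*[v]$ and $v_2\in T[v]$; it is called the primal-dual ancestor $\mathsf{pda}(v_1,v_2)$. -}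

module Defs where

open import Data.Nat using (ℕ; zero; suc; _<_; _≤_)
open import Data.List using (List; []; _∷_; _++_; [_]; length)
open import Data.Maybe using (Maybe; just; nothing; maybe)
open import Data.Product using (∃; _×_)
open import Data.Sum using (_⊎_)
open import Relation.Binary.PropositionalEquality using (_≡_)
open import Relation.Nullary using (¬_)

data Tree : Set where
  node : List Tree → Tree

children : Tree → List Tree
children (node ts) = ts

nth : {A : Set} → List A → ℕ → Maybe A
nth []       _       = nothing
nth (x ∷ xs) zero    = just x
nth (x ∷ xs) (suc n) = nth xs n

-- Vertices of T are addressed by paths from the root: a list of child indices
-- (0-based, left to right).  The root is the empty path [].
subtreeAt : Tree → List ℕ → Maybe Tree
subtreeAt t []            = just t
subtreeAt (node ts) (i ∷ p) with nth ts i
... | nothing = nothing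
... | just s  = subtreeAt s p

Vertex : Tree → List ℕ → Set
Vertex t p = ∃ λ s → subtreeAt t p ≡ just s

childCount : Tree → List ℕ → ℕ
childCount t p = maybe (λ s → length (children s)) 0 (subtreeAt t p)

depth : List ℕ → ℕ
depth = length

-- Depth-first (preorder) traversal order on vertices: a vertex precedes its
-- descendants, and the subtree of a left sibling precedes that of a right sibling.
data _<ᵈ_ : List ℕ → List ℕ → Set where
  root< : ∀ {x xs} → [] <ᵈ (x ∷ xs)
  left< : ∀ {x y xs ys} → x < y → (x ∷ xs) <ᵈ (y ∷ ys)
  same< : ∀ {x xs ys} → xs <ᵈ ys → (x ∷ xs) <ᵈ (x ∷ ys)

_≤ᵈ_ : List ℕ → List ℕ → Set
p ≤ᵈ q = p <ᵈ q ⊎ p ≡ q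

InSubtree : Tree → List ℕ → List ℕ → Set
InSubtree t v w = Vertex t w × ∃ λ s → w ≡ v ++ s

-- DualParent T u w : u is the parent of w in the dual tree T*, following
-- rules (1b), (2), (3) of the definition.
data DualParent (t : Tree) : List ℕ → List ℕ → Set where
  -- (1b) w = rmc_T(r): parent of w in T* is r
  rmcRoot : ∀ {i} → suc i ≡ childCount t [] → DualParent t [] [ i ]
  -- (2) w = rmc_T(p), p ≠ r: w is the immediate left sibling of p in T*,
  --     hence has the same T*-parent as p
  rmcInner : ∀ {p i u} → ¬ (p ≡ []) → suc i ≡ childCount t p →
             DualParent t u p → DualParent t u (p ++ [ i ])
  -- (3) w = ils_T(u) where u = p ++ [suc i]: w is the rightmost child of u in T*
  ils : ∀ {p i} → suc i < childCount t p →
        DualParent t (p ++ [ suc i ]) (p ++ [ i ])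

data DualAnc (t : Tree) (v : List ℕ) : List ℕ → Set where
  here : Vertex t v → DualAnc t v v
  step : ∀ {u w} → DualParent t u w → DualAnc t v u → DualAnc t v w

IsPDA : Tree → List ℕ → List ℕ → List ℕ → Set
IsPDA t v₁ v₂ v = Vertex t v × ¬ (v ≡ []) × DualAnc t v v₁ × InSubtree t v v₂

InInterval : Tree → List ℕ → List ℕ → List ℕ → Set
InInterval t v₁ v₂ x = Vertex t x × v₁ ≤ᵈ x × x ≤ᵈ v₂

HasMinDepth : Tree → List ℕ → List ℕ → List ℕ → Set
HasMinDepth t v₁ v₂ x =
  InInterval t v₁ v₂ x × (∀ y → InInterval t v₁ v₂ y → depth x ≤ depth y)

IsLastMinDepth : Tree → List ℕ → List ℕ → List ℕ → Set
IsLastMinDepth t v₁ v₂ x =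
  HasMinDepth t v₁ v₂ x × (∀ y → HasMinDepth t v₁ v₂ y → y ≤ᵈ x)

module Submission where

open import Defs
open import Data.Nat using (ℕ; zero; suc; _<_; _≤_; z≤n; s≤s)
open import Data.Nat.Base using (_≤‴_; ≤‴-refl; ≤‴-step)
open import Data.Nat.Properties using (<-asym; <-irrefl; <-trans; ≤-<-trans; ≤⇒≤‴; ≤‴⇒≤; n<1+n)
open import Data.List using (List; []; _∷_; _++_; [_]; length)
open import Data.List.Properties using (++-assoc; ++-identityʳ; ++-conicalʳ; ∷-injectiveˡ; ∷-injectiveʳ)
open import Data.Maybe using (just; nothing; maybe; _>>=_)
open import Data.Product using (∃; _×_; _,_)
open import Data.Sum using (_⊎_; inj₁; inj₂)
open import Data.Empty using (⊥-elim)
open import Relation.Binary.PropositionalEquality using (_≡_; _≢_; refl; sym; trans; cong; subst; subst₂)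
open import Relation.Nullary using (¬_)

-- Write v₁ = a ++ m ∷ s and v₂ = a ++ j ∷ s′ with m < j (or v₂ = v₁ ++ s′ when v₁ is an
-- ancestor of v₂), and let x = a ++ [ j ] (resp. x = v₁).  Every vertex strictly between
-- v₁ and v₂ in preorder lies below a ++ [ m′ ] for some m ≤ m′ ≤ j, so x is the last vertex
-- of minimal depth in the interval.  On the dual side, the dual ancestors of a vertex w are
-- w, the root, and the right siblings of the ancestors of w: rule (3) climbs from a child to
-- its right siblings, and rule (2) lets every vertex on the rightmost branch below a vertex
-- share its dual parent.  Hence x is a dual ancestor of v₁ and an ancestor of v₂, and it is
-- the only non-root vertex with both properties.

++-∷≢[] : ∀ (p : List ℕ) {i s} → p ++ i ∷ s ≢ []
++-∷≢[] p e with ++-conicalʳ p _ e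
... | ()

nth-just⇒< : ∀ (ts : List Tree) i {s} → nth ts i ≡ just s → i < length ts
nth-just⇒< (_ ∷ _)  zero    _ = s≤s z≤n
nth-just⇒< (_ ∷ ts) (suc i) e = s≤s (nth-just⇒< ts i e)

<⇒nth-just : ∀ (ts : List Tree) {i} → i < length ts → ∃ λ s → nth ts i ≡ just s
<⇒nth-just (t ∷ _)  {zero}  _         = t , refl
<⇒nth-just (_ ∷ ts) {suc i} (s≤s i<n) = <⇒nth-just ts i<n

subtreeAt-snoc : ∀ t p i → subtreeAt t (p ++ [ i ]) ≡ (subtreeAt t p >>= λ s → nth (children s) i)
subtreeAt-snoc (node ts) [] i with nth ts i
... | nothing = refl
... | just _  = refl
subtreeAt-snoc (node ts) (j ∷ p) i with nth ts j
... | nothing = refl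
... | just s  = subtreeAt-snoc s p i

Vertex-prefix : ∀ t p q → Vertex t (p ++ q) → Vertex t p
Vertex-prefix t         []      q _ = t , refl
Vertex-prefix (node ts) (i ∷ p) q v with nth ts i
... | just s = Vertex-prefix s p q v

Vertex⇒<childCount : ∀ t p {i} → Vertex t (p ++ [ i ]) → i < childCount t p
Vertex⇒<childCount t p {i} (s , e) = child⇒< (subtreeAt t p) (trans (sym (subtreeAt-snoc t p i)) e)
  where
  child⇒< : ∀ m → (m >>= λ u → nth (children u) i) ≡ just s →
            i < maybe (λ u → length (children u)) 0 m
  child⇒< (just (node ts)) e = nth-just⇒< ts i e

<childCount⇒Vertex : ∀ t p {i} → i < childCount t p → Vertex t (p ++ [ i ])
<childCount⇒Vertex t p {i} i<n =
  subst (λ m → ∃ λ s → m ≡ just s) (sym (subtreeAt-snoc t p i)) (<⇒child (subtreeAt t p) i<n)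
  where
  <⇒child : ∀ m → i < maybe (λ u → length (children u)) 0 m →
            ∃ λ s → (m >>= λ u → nth (children u) i) ≡ just s
  <⇒child (just (node ts)) i<n = <⇒nth-just ts i<n

data RightSiblingOfAncestor : List ℕ → List ℕ → Set where
  sibling : ∀ {m j s} → m < j → RightSiblingOfAncestor [ j ] (m ∷ s)
  under   : ∀ {x v w} → RightSiblingOfAncestor v w → RightSiblingOfAncestor (x ∷ v) (x ∷ w)

RightSiblingOfAncestor-snoc : ∀ {v w i} → RightSiblingOfAncestor v w → RightSiblingOfAncestor v (w ++ [ i ])
RightSiblingOfAncestor-snoc (sibling m<j) = sibling m<j
RightSiblingOfAncestor-snoc (under r)     = under (RightSiblingOfAncestor-snoc r)

RightSiblingOfAncestor-suc : ∀ p i → RightSiblingOfAncestor (p ++ [ suc i ]) (p ++ [ i ])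
RightSiblingOfAncestor-suc []      i = sibling (n<1+n i)
RightSiblingOfAncestor-suc (x ∷ p) i = under (RightSiblingOfAncestor-suc p i)

RightSiblingOfAncestor-trans : ∀ {u v w} → RightSiblingOfAncestor u v → RightSiblingOfAncestor v w →
                               RightSiblingOfAncestor u w
RightSiblingOfAncestor-trans (sibling m<j) (sibling l<m) = sibling (<-trans l<m m<j)
RightSiblingOfAncestor-trans (sibling m<j) (under _)     = sibling m<j
RightSiblingOfAncestor-trans (under r)     (under r′)    = under (RightSiblingOfAncestor-trans r r′)

module _ (t : Tree) where

  DualAnc-trans : ∀ {u v w} → DualAnc t u v → DualAnc t v w → DualAnc t u w
  DualAnc-trans u↠v (here _)       = u↠v
  DualAnc-trans u↠v (step x→w v↠x) = step x→w (DualAnc-trans u↠v v↠x)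

  DualAnc⁺ : List ℕ → List ℕ → Set
  DualAnc⁺ v w = ∃ λ u → DualParent t u w × DualAnc t v u

  DualAnc⁺⇒DualAnc : ∀ {v w} → DualAnc⁺ v w → DualAnc t v w
  DualAnc⁺⇒DualAnc (_ , u→w , v↠u) = step u→w v↠u

  DualAnc⁺-DualAnc : ∀ {u v w} → DualAnc⁺ u v → DualAnc t v w → DualAnc⁺ u w
  DualAnc⁺-DualAnc u↠⁺v (here _)       = u↠⁺v
  DualAnc⁺-DualAnc u↠⁺v (step x→w v↠x) = _ , x→w , DualAnc-trans (DualAnc⁺⇒DualAnc u↠⁺v) v↠x

  DualParent⇒RightSiblingOfAncestor : ∀ {u w} → DualParent t u w → u ≡ [] ⊎ RightSiblingOfAncestor u w
  DualParent⇒RightSiblingOfAncestor (rmcRoot _) = inj₁ refl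
  DualParent⇒RightSiblingOfAncestor (rmcInner _ _ u→p) with DualParent⇒RightSiblingOfAncestor u→p
  ... | inj₁ u≡r = inj₁ u≡r
  ... | inj₂ r   = inj₂ (RightSiblingOfAncestor-snoc r)
  DualParent⇒RightSiblingOfAncestor (ils {p} {i} _) = inj₂ (RightSiblingOfAncestor-suc p i)

  DualAnc⇒RightSiblingOfAncestor : ∀ {v w} → DualAnc t v w → v ≡ w ⊎ v ≡ [] ⊎ RightSiblingOfAncestor v w
  DualAnc⇒RightSiblingOfAncestor (here _) = inj₁ refl
  DualAnc⇒RightSiblingOfAncestor (step u→w v↠u)
    with DualAnc⇒RightSiblingOfAncestor v↠u | DualParent⇒RightSiblingOfAncestor u→w
  ... | inj₁ refl        | u-shape  = inj₂ u-shape
  ... | inj₂ (inj₁ v≡r)  | _        = inj₂ (inj₁ v≡r)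
  ... | inj₂ (inj₂ ())   | inj₁ refl
  ... | inj₂ (inj₂ r)    | inj₂ r′  = inj₂ (inj₂ (RightSiblingOfAncestor-trans r r′))

  siblings-DualAnc : ∀ p {i k} → i ≤‴ k → k < childCount t p → DualAnc t (p ++ [ k ]) (p ++ [ i ])
  siblings-DualAnc p ≤‴-refl          k<n = here (<childCount⇒Vertex t p k<n)
  siblings-DualAnc p (≤‴-step 1+i≤k) k<n =
    step (ils (≤-<-trans (≤‴⇒≤ 1+i≤k) k<n)) (siblings-DualAnc p 1+i≤k k<n)

  rightSibling-DualAnc⁺ : ∀ p {i k} → i < k → k < childCount t p → DualAnc⁺ (p ++ [ k ]) (p ++ [ i ])
  rightSibling-DualAnc⁺ p {i} i<k k<n =
    p ++ [ suc i ] , ils (≤-<-trans i<k k<n) , siblings-DualAnc p (≤⇒≤‴ i<k) k<n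

  -- The rightmost child of q gets the dual parent of q by rule (2); its left siblings climb to it.
  DualAnc⁺-child : ∀ {v q i} → q ≢ [] → DualAnc⁺ v q → i < childCount t q → DualAnc⁺ v (q ++ [ i ])
  DualAnc⁺-child {q = q} q≢r (u , u→q , v↠u) i<n with childCount t q in n≡
  DualAnc⁺-child {q = q} q≢r (u , u→q , v↠u) (s≤s i≤k) | suc k =
    DualAnc⁺-DualAnc (u , rmcInner q≢r (sym n≡) u→q , v↠u)
                     (siblings-DualAnc q (≤⇒≤‴ i≤k) (subst (k <_) (sym n≡) (n<1+n k)))

  DualAnc⁺-descendant : ∀ {v q} s → q ≢ [] → DualAnc⁺ v q → Vertex t (q ++ s) → DualAnc⁺ v (q ++ s)
  DualAnc⁺-descendant {q = q} []      _   v↠⁺q _ = subst (DualAnc⁺ _) (sym (++-identityʳ q)) v↠⁺q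
  DualAnc⁺-descendant {q = q} (i ∷ s) q≢r v↠⁺q q++i∷s∈t =
    subst (DualAnc⁺ _) (++-assoc q [ i ] s)
      (DualAnc⁺-descendant s (++-∷≢[] q)
        (DualAnc⁺-child q≢r v↠⁺q (Vertex⇒<childCount t q (Vertex-prefix t (q ++ [ i ]) s qi++s∈t)))
        qi++s∈t)
    where
    qi++s∈t : Vertex t ((q ++ [ i ]) ++ s)
    qi++s∈t = subst (Vertex t) (sym (++-assoc q [ i ] s)) q++i∷s∈t

  RightSiblingOfAncestor⇒DualAnc⁺ : ∀ c {v w} → RightSiblingOfAncestor v w →
    Vertex t (c ++ v) → Vertex t (c ++ w) → DualAnc⁺ (c ++ v) (c ++ w)
  RightSiblingOfAncestor⇒DualAnc⁺ c {w = m ∷ s} (sibling m<j) c++j∈t c++w∈t =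
    subst (DualAnc⁺ _) (++-assoc c [ m ] s)
      (DualAnc⁺-descendant s (++-∷≢[] c)
        (rightSibling-DualAnc⁺ c m<j (Vertex⇒<childCount t c c++j∈t))
        (subst (Vertex t) (sym (++-assoc c [ m ] s)) c++w∈t))
  RightSiblingOfAncestor⇒DualAnc⁺ c {x ∷ v} {x ∷ w} (under r) c++v∈t c++w∈t =
    subst₂ DualAnc⁺ (++-assoc c [ x ] v) (++-assoc c [ x ] w)
      (RightSiblingOfAncestor⇒DualAnc⁺ (c ++ [ x ]) r
        (subst (Vertex t) (sym (++-assoc c [ x ] v)) c++v∈t)
        (subst (Vertex t) (sym (++-assoc c [ x ] w)) c++w∈t))

<ᵈ-asym : ∀ {p q} → p <ᵈ q → ¬ (q <ᵈ p)
<ᵈ-asym (left< x<y)  (left< y<x)  = <-asym x<y y<x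
<ᵈ-asym (left< x<x)  (same< _)    = <-irrefl refl x<x
<ᵈ-asym (same< _)    (left< x<x)  = <-irrefl refl x<x
<ᵈ-asym (same< p<q)  (same< q<p)  = <ᵈ-asym p<q q<p

≤ᵈ-antisym : ∀ {p q} → p ≤ᵈ q → q ≤ᵈ p → p ≡ q
≤ᵈ-antisym (inj₂ p≡q)  _           = p≡q
≤ᵈ-antisym (inj₁ _)    (inj₂ q≡p)  = sym q≡p
≤ᵈ-antisym (inj₁ p<q)  (inj₁ q<p)  = ⊥-elim (<ᵈ-asym p<q q<p)

[]-≤ᵈ : ∀ p → [] ≤ᵈ p
[]-≤ᵈ []      = inj₂ refl
[]-≤ᵈ (_ ∷ _) = inj₁ root<

∷-mono-≤ᵈ : ∀ {x p q} → p ≤ᵈ q → (x ∷ p) ≤ᵈ (x ∷ q)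
∷-mono-≤ᵈ (inj₁ p<q)  = inj₁ (same< p<q)
∷-mono-≤ᵈ (inj₂ refl) = inj₂ refl

∷-cancel-≤ᵈ : ∀ {x p q} → (x ∷ p) ≤ᵈ (x ∷ q) → p ≤ᵈ q
∷-cancel-≤ᵈ (inj₁ (left< x<x)) = ⊥-elim (<-irrefl refl x<x)
∷-cancel-≤ᵈ (inj₁ (same< p<q)) = inj₁ p<q
∷-cancel-≤ᵈ (inj₂ refl)        = inj₂ refl

∷-≤ᵈ-between : ∀ {x p q y} → (x ∷ p) ≤ᵈ y → y ≤ᵈ (x ∷ q) → ∃ λ y′ → y ≡ x ∷ y′ × p ≤ᵈ y′ × y′ ≤ᵈ q
∷-≤ᵈ-between {p = p} (inj₂ refl) y≤x∷q = p , refl , inj₂ refl , ∷-cancel-≤ᵈ y≤x∷q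
∷-≤ᵈ-between (inj₁ (left< x<y)) (inj₁ (left< y<x)) = ⊥-elim (<-asym x<y y<x)
∷-≤ᵈ-between (inj₁ (left< x<x)) (inj₁ (same< _))   = ⊥-elim (<-irrefl refl x<x)
∷-≤ᵈ-between (inj₁ (left< x<x)) (inj₂ refl)        = ⊥-elim (<-irrefl refl x<x)
∷-≤ᵈ-between {y = _ ∷ y′} (inj₁ (same< p<y′)) y≤x∷q = y′ , refl , inj₁ p<y′ , ∷-cancel-≤ᵈ y≤x∷q

-- v₁ itself if v₁ is an ancestor of v₂, otherwise the child towards v₂ of their lowest
-- common ancestor.
pda : ∀ {v₁ v₂} → v₁ <ᵈ v₂ → List ℕ
pda root<             = []
pda (left< {y = j} _) = [ j ]
pda (same< {x = x} d) = x ∷ pda d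

pda-between : ∀ {v₁ v₂} (d : v₁ <ᵈ v₂) → v₁ ≤ᵈ pda d × pda d ≤ᵈ v₂
pda-between root<                = inj₂ refl , inj₁ root<
pda-between (left< {ys = q} x<j) = inj₁ (left< x<j) , ∷-mono-≤ᵈ ([]-≤ᵈ q)
pda-between (same< d) with pda-between d
... | v₁≤x , x≤v₂ = ∷-mono-≤ᵈ v₁≤x , ∷-mono-≤ᵈ x≤v₂

pda-ancestor : ∀ {v₁ v₂} (d : v₁ <ᵈ v₂) → ∃ λ s → v₂ ≡ pda d ++ s
pda-ancestor (root< {x} {q})    = x ∷ q , refl
pda-ancestor (left< {ys = q} _) = q , refl
pda-ancestor (same< {x = x} d) with pda-ancestor d
... | s , v₂≡x++s = s , cong (x ∷_) v₂≡x++s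

pda≡[] : ∀ {v₁ v₂} (d : v₁ <ᵈ v₂) → pda d ≡ [] → v₁ ≡ []
pda≡[] root<     _ = refl
pda≡[] (left< _) ()
pda≡[] (same< _) ()

pda-minDepth : ∀ {v₁ v₂} (d : v₁ <ᵈ v₂) y → v₁ ≤ᵈ y → y ≤ᵈ v₂ → depth (pda d) ≤ depth y
pda-minDepth root<     _       _        _    = z≤n
pda-minDepth (left< _) (_ ∷ _) _        _    = s≤s z≤n
pda-minDepth (left< _) []      (inj₁ ()) _
pda-minDepth (left< _) []      (inj₂ ()) _
pda-minDepth (same< d) y       v₁≤y     y≤v₂ with ∷-≤ᵈ-between v₁≤y y≤v₂
... | y′ , refl , v₁′≤y′ , y′≤v₂′ = s≤s (pda-minDepth d y′ v₁′≤y′ y′≤v₂′)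

pda-last : ∀ {v₁ v₂} (d : v₁ <ᵈ v₂) y → v₁ ≤ᵈ y → y ≤ᵈ v₂ → depth y ≤ depth (pda d) → y ≤ᵈ pda d
pda-last root<     []          _         _                   _         = inj₂ refl
pda-last (left< _) []          (inj₁ ()) _                   _
pda-last (left< _) []          (inj₂ ()) _                   _
pda-last (left< _) (_ ∷ [])    _         (inj₁ (left< z<j)) _         = inj₁ (left< z<j)
pda-last (left< _) (_ ∷ [])    _         (inj₁ (same< _))   _         = inj₂ refl
pda-last (left< _) (_ ∷ [])    _         (inj₂ refl)        _         = inj₂ refl
pda-last (left< _) (_ ∷ _ ∷ _) _         _                   (s≤s ())
pda-last (same< d) y           v₁≤y      y≤v₂                depth≤ with ∷-≤ᵈ-between v₁≤y y≤v₂
pda-last (same< d) _ _ _ (s≤s depth≤) | y′ , refl , v₁′≤y′ , y′≤v₂′ =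
  ∷-mono-≤ᵈ (pda-last d y′ v₁′≤y′ y′≤v₂′ depth≤)

pda≡⊎RightSiblingOfAncestor : ∀ {v₁ v₂} (d : v₁ <ᵈ v₂) → pda d ≡ v₁ ⊎ RightSiblingOfAncestor (pda d) v₁
pda≡⊎RightSiblingOfAncestor root<       = inj₁ refl
pda≡⊎RightSiblingOfAncestor (left< x<j) = inj₂ (sibling x<j)
pda≡⊎RightSiblingOfAncestor (same< {x = x} d) with pda≡⊎RightSiblingOfAncestor d
... | inj₁ x≡v₁ = inj₁ (cong (x ∷_) x≡v₁)
... | inj₂ r    = inj₂ (under r)

pda-unique : ∀ {v₁ v₂ v} (d : v₁ <ᵈ v₂) → v ≡ v₁ ⊎ RightSiblingOfAncestor v v₁ →
             (∃ λ s → v₂ ≡ v ++ s) → v ≡ pda d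
pda-unique root<       (inj₁ refl)          _       = refl
pda-unique (left< x<y) (inj₁ refl)          (_ , e) = ⊥-elim (<-irrefl (sym (∷-injectiveˡ e)) x<y)
pda-unique (left< _)   (inj₂ (sibling _))   (_ , e) = cong [_] (sym (∷-injectiveˡ e))
pda-unique (left< x<y) (inj₂ (under _))     (_ , e) = ⊥-elim (<-irrefl (sym (∷-injectiveˡ e)) x<y)
pda-unique (same< d)   (inj₂ (sibling x<x)) (_ , e) = ⊥-elim (<-irrefl (∷-injectiveˡ e) x<x)
pda-unique (same< {x = x} d) (inj₁ refl)    (s , e) = cong (x ∷_) (pda-unique d (inj₁ refl) (s , ∷-injectiveʳ e))
pda-unique (same< {x = x} d) (inj₂ (under r)) (s , e) = cong (x ∷_) (pda-unique d (inj₂ r) (s , ∷-injectiveʳ e))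

IsLastMinDepth-unique : ∀ {t v₁ v₂ x y} → IsLastMinDepth t v₁ v₂ x → IsLastMinDepth t v₁ v₂ y → x ≡ y
IsLastMinDepth-unique (x-min , x-last) (y-min , y-last) = ≤ᵈ-antisym (y-last _ x-min) (x-last _ y-min)

module _ (t : Tree) {v₁ v₂ : List ℕ} (d : v₁ <ᵈ v₂) where

  pda-Vertex : Vertex t v₂ → Vertex t (pda d)
  pda-Vertex v₂∈t with pda-ancestor d
  ... | s , v₂≡x++s = Vertex-prefix t (pda d) s (subst (Vertex t) v₂≡x++s v₂∈t)

  pda-IsLastMinDepth : Vertex t v₂ → IsLastMinDepth t v₁ v₂ (pda d)
  pda-IsLastMinDepth v₂∈t = x-min , λ { y ((_ , v₁≤y , y≤v₂) , y-minimal) →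
                                           pda-last d y v₁≤y y≤v₂ (y-minimal _ x∈[v₁,v₂]) }
    where
    x∈[v₁,v₂] : InInterval t v₁ v₂ (pda d)
    x∈[v₁,v₂] = pda-Vertex v₂∈t , pda-between d
    x-min : HasMinDepth t v₁ v₂ (pda d)
    x-min = x∈[v₁,v₂] , λ { y (_ , v₁≤y , y≤v₂) → pda-minDepth d y v₁≤y y≤v₂ }

  pda-IsPDA : Vertex t v₁ → v₁ ≢ [] → Vertex t v₂ → IsPDA t v₁ v₂ (pda d)
  pda-IsPDA v₁∈t v₁≢r v₂∈t =
    x∈t , (λ x≡r → v₁≢r (pda≡[] d x≡r)) , x↠v₁ (pda≡⊎RightSiblingOfAncestor d) , v₂∈t , pda-ancestor d
    where
    x∈t : Vertex t (pda d)
    x∈t = pda-Vertex v₂∈t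
    x↠v₁ : pda d ≡ v₁ ⊎ RightSiblingOfAncestor (pda d) v₁ → DualAnc t (pda d) v₁
    x↠v₁ (inj₁ x≡v₁) = subst (λ x → DualAnc t x v₁) (sym x≡v₁) (here v₁∈t)
    x↠v₁ (inj₂ r)    = DualAnc⁺⇒DualAnc t (RightSiblingOfAncestor⇒DualAnc⁺ t [] r x∈t v₁∈t)

  IsPDA⇒≡pda : ∀ {v} → IsPDA t v₁ v₂ v → v ≡ pda d
  IsPDA⇒≡pda (_ , v≢r , v↠v₁ , _ , v₂∈T[v]) with DualAnc⇒RightSiblingOfAncestor t v↠v₁
  ... | inj₁ v≡v₁        = pda-unique d (inj₁ v≡v₁) v₂∈T[v]
  ... | inj₂ (inj₁ v≡r)  = ⊥-elim (v≢r v≡r)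
  ... | inj₂ (inj₂ r)    = pda-unique d (inj₂ r) v₂∈T[v]

theorem6 : (t : Tree) (v₁ v₂ : List ℕ) →
           Vertex t v₁ → ¬ (v₁ ≡ []) → Vertex t v₂ → ¬ (v₂ ≡ []) → v₁ <ᵈ v₂ →
           (∃ λ x → IsLastMinDepth t v₁ v₂ x) ×
           (∀ x → IsLastMinDepth t v₁ v₂ x →
              IsPDA t v₁ v₂ x × (∀ v → IsPDA t v₁ v₂ v → v ≡ x))
theorem6 t v₁ v₂ v₁∈t v₁≢r v₂∈t _ d = (pda d , x-last) , λ x′ x′-last →
  subst (λ x → IsPDA t v₁ v₂ x × (∀ v → IsPDA t v₁ v₂ v → v ≡ x))
        (IsLastMinDepth-unique x-last x′-last)
        (pda-IsPDA t d v₁∈t v₁≢r v₂∈t , λ _ → IsPDA⇒≡pda t d)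
  where
  x-last : IsLastMinDepth t v₁ v₂ (pda d)
  x-last = pda-IsLastMinDepth t d v₂∈t
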